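{- Let $d\ge3$ be odd, $\lambda$ a bar partition and $q=\bar q_d(\lambda)=(b_1>\dots>b_t>0)$. For $1\le r\le t$, let $z$ be the hook of $D(q)$ at node $(r,t+1)$, which has length $b_r$, and let $z^{\times2}$ be the hook of $D(q)$ at the diagonal node $(r,r)$, which has length $2b_r$. Then $\bar h(z^{\times2})=2\bar h(z)$.
   Context: For a bar partition $\mu=(a_1>\dots>a_m>0)$ (distinct parts), $D(\mu)$ is the partition with Frobenius symbol $(a_1,\dots,a_m\mid a_1-1,\dots,a_m-1)$; for $r\le m$, row $r$ has length $a_r+r$ and column $r$ has length $a_r+r-1$. Young diagrams are in English convention, with node $(r,c)$ in row $r$, column $c$. The hook at $(r,c)$ of a partition $\nu$ has length $h=\nu_r-c+\nu'_c-r+1$, hand node $(r,\nu_r)$ and foot node $(\nu'_c,c)$. Node residue is $[c-r]_d$, the least non-negative residue mod $d$. $H_{i\to j}(\nu)$ is the set of hooks with hand residue $i$ and foot residue $[j+1]_d$. For a partition $\nu$, its minimally normalized $\beta$-set is $X=\{\nu_s+k-s\mid 1\le s\le k\}$, where $k$ is the least multiple of $d$ that is at least the number of nonzero parts. Runner $i$ is $\{x\in X:x\equiv i \bmod d\}$. The $d$-quotient is the tuple of partitions with $\beta$-sets $\{(x-i)/d\}$ from runner $i$. $\bar q_d(\lambda)$ is the unique bar partition $\mu$ such that $D(\mu)$ has empty $d$-core and the same $d$-quotient as $D(\lambda)$. $x_i$ is the number of beads on runner $i$ of the minimally normalized $d$-abacus of $D(\lambda)$. For $z\in H_{i\to j}(D(q))$,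 $\bar h(z)=h(z)+(x_i-x_j)d$. -}

module Defs where

open import Data.Nat using (ℕ; zero; suc; _+_; _*_; _∸_; _≤_; _<_; _≤?_; _<?_; NonZero)
open import Data.Nat.DivMod using (_/_; _%_)
open import Data.Nat.Properties using (_≟_)
open import Data.Integer.Base as ℤ using (ℤ; +_; _%ℕ_)
open import Data.List using (List; []; _∷_; length; map; filter; upTo; downFrom)
open import Data.List.Relation.Unary.All using (All)
open import Data.List.Relation.Unary.Linked using (Linked)
open import Data.Nat using (_>_)
open import Data.Product using (_×_)
open import Relation.Nullary using (yes; no)

-- Partitions and bar partitions are lists of natural numbers (largest part first).

IsBar : List ℕ → Set
IsBar μ = Linked _>_ μ × All (λ a → 0 < a) μ

-- 1-indexed lookup, 0 outside the list.
nth : List ℕ → ℕ → ℕ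
nth []       _             = 0
nth (x ∷ xs) zero          = 0
nth (x ∷ xs) (suc zero)    = x
nth (x ∷ xs) (suc (suc n)) = nth xs (suc n)

range1 : ℕ → List ℕ
range1 n = map suc (upTo n)

-- D(μ): Frobenius symbol (a_1..a_m | a_1-1..a_m-1).
-- Row r (r ≤ m) has length a_r + r; column c (c ≤ m) has length a_c + c - 1.
-- For r > m, row r has length #{c ≤ m : a_c + c - 1 ≥ r}.
D : List ℕ → List ℕ
D μ = map row (range1 (nth μ 1))
  where
  m = length μ
  row : ℕ → ℕ
  row r with r ≤? m
  ... | yes _ = nth μ r + r
  ... | no  _ =
        length (filter (λ c → r ≤? (nth μ c + c ∸ 1)) (range1 m))

rowLen : List ℕ → ℕ → ℕ
rowLen = nth

colLen : List ℕ → ℕ → ℕ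
colLen ν c = length (filter (λ p → c ≤? p) ν)

res : (d : ℕ) .{{_ : NonZero d}} → ℤ → ℕ
res d z = z %ℕ d

hookLen : List ℕ → ℕ → ℕ → ℕ
hookLen ν r c = (rowLen ν r ∸ c) + (colLen ν c ∸ r) + 1

handRes : (d : ℕ) .{{_ : NonZero d}} → List ℕ → ℕ → ℕ → ℕ
handRes d ν r c = res d (+ rowLen ν r ℤ.- + r)

footRes : (d : ℕ) .{{_ : NonZero d}} → List ℕ → ℕ → ℕ → ℕ
footRes d ν r c = res d (+ c ℤ.- + colLen ν c)

-- Abacus.  k = least multiple of d that is ≥ number of nonzero parts.
numParts : List ℕ → ℕ
numParts ν = length (filter (λ p → 0 <? p) ν)

abacusSize : (d : ℕ) .{{_ : NonZero d}} → List ℕ → ℕ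
abacusSize d ν = ((numParts ν + (d ∸ 1)) / d) * d

betaSet : (d : ℕ) .{{_ : NonZero d}} → List ℕ → List ℕ
betaSet d ν = map (λ s → rowLen ν s + k ∸ s) (range1 k)
  where k = abacusSize d ν

runner : (d : ℕ) .{{_ : NonZero d}} → List ℕ → ℕ → List ℕ
runner d ν i = filter (λ x → x % d ≟ i) (betaSet d ν)

beads : (d : ℕ) .{{_ : NonZero d}} → List ℕ → ℕ → ℕ
beads d ν i = length (runner d ν i)

-- Partition with a given β-set (given as a strictly decreasing list b_1 > ... > b_n):
-- parts b_s - (n - s), zero parts removed.
partOfβ : List ℕ → List ℕ
partOfβ bs = filter (λ p → 0 <? p) (go bs)
  where
  go : List ℕ → List ℕ
  go []       = []
  go (b ∷ bs) = (b ∸ length bs) ∷ go bs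

quotient : (d : ℕ) .{{_ : NonZero d}} → List ℕ → List (List ℕ)
quotient d ν = map (λ i → partOfβ (map (λ x → (x ∸ i) / d) (runner d ν i))) (upTo d)

-- d-core: slide all beads up their runners (runner i keeps x_i beads at
-- positions i, i+d, ..., i+(x_i-1)d) and read off the partition.
coreβ : (d : ℕ) .{{_ : NonZero d}} → List ℕ → List ℕ
coreβ d ν = filter (λ p → p / d <? beads d ν (p % d)) (downFrom (d * suc (abacusSize d ν)))

core : (d : ℕ) .{{_ : NonZero d}} → List ℕ → List ℕ
core d ν = partOfβ (coreβ d ν)

-- h̄(z) for the hook z of ν at (r,c), z ∈ H_{i→j}(ν) with i the hand residue and
-- j = [foot residue - 1]_d;  h̄(z) = h(z) + (x_i - x_j) d, x from the abacus of D(lam).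
hbar : (d : ℕ) .{{_ : NonZero d}} → (lam ν : List ℕ) → ℕ → ℕ → ℤ
hbar d lam ν r c =
  + hookLen ν r c ℤ.+ (+ beads d (D lam) i ℤ.- + beads d (D lam) j) ℤ.* + d
  where
  i = handRes d ν r c
  j = (footRes d ν r c + (d ∸ 1)) % d

-- In D(q) the hook at (r, r) has length 2b and the hook at (r, t + 1) has length b, where b = b_r; both
-- have hand residue i = [b], and they lead to the runners j = [−b] and 0 respectively. So the claim reduces to
-- x_i + x_j = 2 x_0 for the abacus of D(λ). Take K beads, K a multiple of d that is at least the largest part
-- of λ: the β-numbers of D(λ) are then K + a for the parts a of λ and K − j for 1 ≤ j ≤ K not a part. This set
-- omits K and contains exactly one of y and 2K − y for every other y ≤ 2K, and y ↦ 2K − y exchanges the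
-- runners i and j; counting over both runners gives x_i + x_j = 2K/d, the same value as for i = j = 0.

module Submission where

module Doubled where

  open import Defs
  open import Data.Bool.Base using (Bool; true; false; _∧_; not; if_then_else_; T)
  open import Data.Bool.Properties using (∧-zeroʳ; ∧-identityʳ; not-¬; not-involutive)
  open import Data.Empty using (⊥; ⊥-elim)
  open import Data.List.Base using (List; []; _∷_; length; map; filter; upTo; downFrom; applyUpTo)
  open import Data.List.Membership.Propositional using (_∈_)
  open import Data.List.Membership.Propositional.Properties using (∈-map⁻; ∈-upTo⁻; ∈-filter⁺; ∈-downFrom⁺)
  open import Data.List.Properties using (map-∘; map-upTo; length-map; length-upTo)
  open import Data.List.Relation.Binary.Pointwise using (Pointwise-≡⇒≡)
  open import Data.List.Relation.Binary.Sublist.Heterogeneous using (Sublist; []; _∷_; _∷ʳ_; minimum)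
  open import Data.List.Relation.Binary.Sublist.Heterogeneous.Properties using (toPointwise)
  open import Data.List.Relation.Unary.All using (All; _∷_)
  open import Data.List.Relation.Unary.Any using (here; there)
  open import Data.List.Relation.Unary.Linked using (Linked; []; [-]; _∷_)
  open import Data.List.Relation.Unary.Linked.Properties using (applyUpTo⁺₁; applyDownFrom⁺₂; filter⁺)
  open import Data.Nat.Base
  open import Data.Nat.DivMod
  open import Data.Nat.Divisibility using (m%n≡0⇒n∣m)
  open import Data.Nat.Properties
  open import Algebra.Properties.CommutativeSemigroup +-commutativeSemigroup using (interchange; x∙yz≈z∙yx; xy∙z≈xz∙y)
  open import Data.List.Membership.DecPropositional _≟_ using (_∈?_)
  open import Data.Product.Base using (_×_; _,_; ∃; proj₁; proj₂)
  open import Function.Base using (_∘_; id)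
  open import Function.Bundles using (mk⇔)
  open import Level using (Level)
  open import Relation.Binary.Definitions using (tri<; tri≈; tri>)
  open import Relation.Binary.PropositionalEquality
  open import Relation.Nullary.Decidable using (yes; no; does; _×-dec_; dec-true; dec-false; does-⇔; ¬?; T?)
  open import Relation.Unary using (Pred; Decidable)

  -- Counting below a bound

  toℕ : Bool → ℕ
  toℕ true  = 1
  toℕ false = 0

  sumBelow : (ℕ → ℕ) → ℕ → ℕ
  sumBelow f zero    = 0
  sumBelow f (suc n) = f 0 + sumBelow (f ∘ suc) n

  count : (ℕ → Bool) → ℕ → ℕ
  count p = sumBelow (toℕ ∘ p)

  sumBelow-cong : ∀ {f g} n → (∀ x → x < n → f x ≡ g x) → sumBelow f n ≡ sumBelow g n
  sumBelow-cong zero    eq = refl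
  sumBelow-cong (suc n) eq = cong₂ _+_ (eq 0 z<s) (sumBelow-cong n (λ x x<n → eq (suc x) (s<s x<n)))

  count-cong : ∀ {p q} n → (∀ x → x < n → p x ≡ q x) → count p n ≡ count q n
  count-cong n eq = sumBelow-cong n (λ x x<n → cong toℕ (eq x x<n))

  sumBelow-+ : ∀ f g n → sumBelow f n + sumBelow g n ≡ sumBelow (λ x → f x + g x) n
  sumBelow-+ f g zero    = refl
  sumBelow-+ f g (suc n) =
    trans (interchange (f 0) _ (g 0) _) (cong (f 0 + g 0 +_) (sumBelow-+ (f ∘ suc) (g ∘ suc) n))

  sumBelow-suc : ∀ f n → sumBelow f (suc n) ≡ sumBelow f n + f n
  sumBelow-suc f zero    = +-comm (f 0) 0
  sumBelow-suc f (suc n) = trans (cong (f 0 +_) (sumBelow-suc (f ∘ suc) n)) (sym (+-assoc (f 0) _ _))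

  sumBelow-split : ∀ f m n → sumBelow f (m + n) ≡ sumBelow f m + sumBelow (λ x → f (m + x)) n
  sumBelow-split f zero    n = refl
  sumBelow-split f (suc m) n = trans (cong (f 0 +_) (sumBelow-split (f ∘ suc) m n)) (sym (+-assoc (f 0) _ _))

  sumBelow-reverse : ∀ f n → sumBelow f n ≡ sumBelow (λ x → f (n ∸ suc x)) n
  sumBelow-reverse f zero    = refl
  sumBelow-reverse f (suc n) = begin
    f 0 + sumBelow (f ∘ suc) n                  ≡⟨ cong (f 0 +_) (sumBelow-reverse (f ∘ suc) n) ⟩
    f 0 + sumBelow (λ x → f (suc (n ∸ suc x))) n ≡⟨ cong (f 0 +_) (sumBelow-cong n (λ x x<n → cong f (sym (+-∸-assoc 1 x<n)))) ⟩
    f 0 + sumBelow (λ x → f (n ∸ x)) n           ≡⟨ +-comm (f 0) _ ⟩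
    sumBelow (λ x → f (n ∸ x)) n + f 0           ≡⟨ cong (λ z → sumBelow (λ x → f (n ∸ x)) n + f z) (sym (n∸n≡0 n)) ⟩
    sumBelow (λ x → f (n ∸ x)) n + f (n ∸ n)     ≡⟨ sym (sumBelow-suc (λ x → f (n ∸ x)) n) ⟩
    sumBelow (λ x → f (suc n ∸ suc x)) (suc n)   ∎
    where open ≡-Reasoning

  sumBelow-0 : ∀ n → sumBelow (λ _ → 0) n ≡ 0
  sumBelow-0 zero    = refl
  sumBelow-0 (suc n) = sumBelow-0 n

  sumBelow-indicator : ∀ g {k n} → k < n → sumBelow (λ x → if x ≡ᵇ k then g x else 0) n ≡ g k
  sumBelow-indicator g {zero}  {suc n} _         = trans (cong (g 0 +_) (sumBelow-0 n)) (+-identityʳ _)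
  sumBelow-indicator g {suc k} {suc n} (s≤s k<n) = sumBelow-indicator (g ∘ suc) k<n

  count≤ : ∀ p n → count p n ≤ n
  count≤ p zero = z≤n
  count≤ p (suc n) with p 0
  ... | true  = s≤s (count≤ (p ∘ suc) n)
  ... | false = m≤n⇒m≤1+n (count≤ (p ∘ suc) n)

  count-mono : ∀ {p q} n → (∀ x → x < n → T (p x) → T (q x)) → count p n ≤ count q n
  count-mono zero    _   = z≤n
  count-mono {p} {q} (suc n) imp with p 0 | q 0 | imp 0 z<s
  ... | true  | true  | _   = s≤s (count-mono n (λ x x<n → imp (suc x) (s<s x<n)))
  ... | false | true  | _   = m≤n⇒m≤1+n (count-mono n (λ x x<n → imp (suc x) (s<s x<n)))
  ... | false | false | _   = count-mono n (λ x x<n → imp (suc x) (s<s x<n))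
  ... | true  | false | imp0 = ⊥-elim (imp0 _)

  count-zero : ∀ {p} n → (∀ x → x < n → p x ≡ false) → count p n ≡ 0
  count-zero n all-false = trans (count-cong n all-false) (sumBelow-0 n)

  count-<ᵇ : ∀ {k n} → k ≤ n → count (_<ᵇ k) n ≡ k
  count-<ᵇ {zero}  {n}     _         = count-zero n (λ _ _ → refl)
  count-<ᵇ {suc k} {suc n} (s≤s k≤n) = cong suc (count-<ᵇ k≤n)

  count-pos : ∀ {p} n → T (p 0) → 0 < n → 0 < count p n
  count-pos {p} (suc n) _ _ with p 0
  ... | true = z<s

  ¬T⇒≡false : ∀ {b} → (T b → ⊥) → b ≡ false
  ¬T⇒≡false {false} _  = refl
  ¬T⇒≡false {true}  ¬t = ⊥-elim (¬t _)

  ≡true⇒T : ∀ {b} → b ≡ true → T b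
  ≡true⇒T refl = _

  DownClosed : (ℕ → Bool) → ℕ → Set
  DownClosed p n = ∀ {x y} → x ≤ y → y < n → T (p y) → T (p x)

  count-initial : ∀ {p} n → DownClosed p n → ∀ {x} → x < n → p x ≡ (x <ᵇ count p n)
  count-initial {p} (suc n) closed {x} x<n with p 0 in p0
  count-initial {p} (suc n) closed {zero}  _         | true = p0
  count-initial {p} (suc n) closed {suc x} (s≤s x<n) | true =
    count-initial n (λ x≤y y<n → closed (s≤s x≤y) (s<s y<n)) x<n
  count-initial {p} (suc n) closed {x} x<n | false =
    trans (nowhere x x<n) (cong (x <ᵇ_) (sym (count-zero n (λ y y<n → nowhere (suc y) (s<s y<n)))))
    where
    nowhere : ∀ y → y < suc n → p y ≡ false
    nowhere y y<n = ¬T⇒≡false (λ pyt → subst T p0 (closed z≤n y<n pyt))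

  module _ {ℓ : Level} {P : Pred ℕ ℓ} (P? : Decidable P) where

    length-filter-∷ : ∀ x xs → length (filter P? (x ∷ xs)) ≡ toℕ (does (P? x)) + length (filter P? xs)
    length-filter-∷ x xs with does (P? x)
    ... | true  = refl
    ... | false = refl

    length-filter-applyUpTo : ∀ h n → length (filter P? (applyUpTo h n)) ≡ count (λ x → does (P? (h x))) n
    length-filter-applyUpTo h zero    = refl
    length-filter-applyUpTo h (suc n) =
      trans (length-filter-∷ (h 0) _) (cong (toℕ (does (P? (h 0))) +_) (length-filter-applyUpTo (h ∘ suc) n))

    length-filter-map-range1 : ∀ g n → length (filter P? (map g (range1 n))) ≡ count (λ x → does (P? (g (suc x)))) n
    length-filter-map-range1 g n rewrite sym (map-∘ {g = g} {f = suc} (upTo n)) | map-upTo (g ∘ suc) n =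
      length-filter-applyUpTo (g ∘ suc) n

    length-filter-range1 : ∀ n → length (filter P? (range1 n)) ≡ count (λ x → does (P? (suc x))) n
    length-filter-range1 n rewrite map-upTo suc n = length-filter-applyUpTo suc n

    length-filter-downFrom : ∀ n → length (filter P? (downFrom n)) ≡ count (λ x → does (P? x)) n
    length-filter-downFrom zero    = refl
    length-filter-downFrom (suc n) = begin
      length (filter P? (n ∷ downFrom n))                 ≡⟨ length-filter-∷ n (downFrom n) ⟩
      toℕ (does (P? n)) + length (filter P? (downFrom n)) ≡⟨ cong (toℕ (does (P? n)) +_) (length-filter-downFrom n) ⟩
      toℕ (does (P? n)) + count (λ x → does (P? x)) n     ≡⟨ +-comm (toℕ (does (P? n))) _ ⟩
      count (λ x → does (P? x)) n + toℕ (does (P? n))     ≡⟨ sym (sumBelow-suc (λ x → toℕ (does (P? x))) n) ⟩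
      count (λ x → does (P? x)) (suc n)                   ∎
      where open ≡-Reasoning

  length-filter-filter : ∀ {ℓ} {P Q : Pred ℕ ℓ} (P? : Decidable P) (Q? : Decidable Q) xs →
    length (filter P? (filter Q? xs)) ≡ length (filter (λ x → Q? x ×-dec P? x) xs)
  length-filter-filter P? Q? []       = refl
  length-filter-filter P? Q? (x ∷ xs) with does (Q? x)
  ... | false = length-filter-filter P? Q? xs
  ... | true with does (P? x)
  ...   | true  = cong suc (length-filter-filter P? Q? xs)
  ...   | false = length-filter-filter P? Q? xs

  nth-applyUpTo : ∀ (h : ℕ → ℕ) n {s} → s < n → nth (applyUpTo h n) (suc s) ≡ h s
  nth-applyUpTo h (suc n) {zero}  _         = refl
  nth-applyUpTo h (suc n) {suc s} (s≤s s<n) = nth-applyUpTo (h ∘ suc) n s<n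

  nth-map-range1 : ∀ (g : ℕ → ℕ) n {s} → s < n → nth (map g (range1 n)) (suc s) ≡ g (suc s)
  nth-map-range1 g n s<n rewrite sym (map-∘ {g = g} {f = suc} (upTo n)) | map-upTo (g ∘ suc) n =
    nth-applyUpTo (g ∘ suc) n s<n

  length-map-range1 : ∀ (g : ℕ → ℕ) n → length (map g (range1 n)) ≡ n
  length-map-range1 g n = trans (length-map g (range1 n)) (trans (length-map suc (upTo n)) (length-upTo n))

  length-filter-map-range1-nth : ∀ {ℓ} {P : Pred ℕ ℓ} (P? : Decidable P) g n →
    length (filter P? (map g (range1 n))) ≡ count (λ x → does (P? (nth (map g (range1 n)) (suc x)))) n
  length-filter-map-range1-nth P? g n = trans (length-filter-map-range1 P? g n)
    (count-cong n (λ x x<n → cong (does ∘ P?) (sym (nth-map-range1 g n x<n))))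

  nth-out : ∀ xs {s} → length xs < s → nth xs s ≡ 0
  nth-out []       _                     = refl
  nth-out (x ∷ xs) {suc (suc s)} (s≤s p) = nth-out xs p

  nth∈ : ∀ xs {c} → 1 ≤ c → c ≤ length xs → nth xs c ∈ xs
  nth∈ (x ∷ xs) {suc zero}    _ _       = here refl
  nth∈ (x ∷ xs) {suc (suc c)} _ (s≤s p) = there (nth∈ xs (s≤s z≤n) p)

  ∈⇒nth : ∀ xs {z} → z ∈ xs → ∃ λ c → 1 ≤ c × c ≤ length xs × nth xs c ≡ z
  ∈⇒nth (x ∷ xs) (here refl) = 1 , s≤s z≤n , s≤s z≤n , refl
  ∈⇒nth (x ∷ xs) (there z∈xs) with ∈⇒nth xs z∈xs
  ... | suc c , _ , c≤ , eq = suc (suc c) , s≤s z≤n , s≤s c≤ , eq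

  Decreasing : List ℕ → Set
  Decreasing = Linked _>_

  Decreasing-tail : ∀ {x xs} → Decreasing (x ∷ xs) → Decreasing xs
  Decreasing-tail [-]     = []
  Decreasing-tail (_ ∷ l) = l

  Decreasing-head : ∀ {x xs z} → Decreasing (x ∷ xs) → z ∈ xs → z < x
  Decreasing-head (x>y ∷ l) (here refl) = x>y
  Decreasing-head (x>y ∷ l) (there z∈)  = <-trans (Decreasing-head l z∈) x>y

  Decreasing-⊆⇒Sublist : ∀ {xs ys} → Decreasing xs → Decreasing ys →
                          (∀ {z} → z ∈ xs → z ∈ ys) → Sublist _≡_ xs ys
  Decreasing-⊆⇒Sublist {[]}              _ _ _   = minimum _
  Decreasing-⊆⇒Sublist {x ∷ xs} {[]}     _ _ xs⊆ with () ← xs⊆ (here refl)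
  Decreasing-⊆⇒Sublist {x ∷ xs} {y ∷ ys} dx dy xs⊆ with xs⊆ (here refl)
  ... | here refl = refl ∷ Decreasing-⊆⇒Sublist (Decreasing-tail dx) (Decreasing-tail dy) tail⊆
    where
    tail⊆ : ∀ {z} → z ∈ xs → z ∈ ys
    tail⊆ z∈ with xs⊆ (there z∈)
    ... | here refl = ⊥-elim (<-irrefl refl (Decreasing-head dx z∈))
    ... | there z∈ys = z∈ys
  ... | there x∈ys = y ∷ʳ Decreasing-⊆⇒Sublist dx (Decreasing-tail dy) shifted
    where
    below : ∀ {z} → z ∈ x ∷ xs → z < y
    below (here refl) = Decreasing-head dy x∈ys
    below (there z∈)  = <-trans (Decreasing-head dx z∈) (Decreasing-head dy x∈ys)
    shifted : ∀ {z} → z ∈ x ∷ xs → z ∈ ys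
    shifted z∈ with xs⊆ z∈
    ... | here refl = ⊥-elim (<-irrefl refl (below z∈))
    ... | there z∈ys = z∈ys

  Decreasing-⊆-length⇒≡ : ∀ {xs ys} → Decreasing xs → Decreasing ys →
                           (∀ {z} → z ∈ xs → z ∈ ys) → length xs ≡ length ys → xs ≡ ys
  Decreasing-⊆-length⇒≡ dx dy xs⊆ eq = Pointwise-≡⇒≡ (toPointwise eq (Decreasing-⊆⇒Sublist dx dy xs⊆))

  -- Mirror symmetry and residues

  module _ (K : ℕ) (h : ℕ → Bool) (h-K : h K ≡ false)
           (h-reflect : ∀ {y} → y ≤ K + K → y ≢ K → h (K + K ∸ y) ≡ not (h y)) where

    private
      N = K + K

      toℕ-b+not-b : ∀ b → toℕ b + toℕ (not b) ≡ 1
      toℕ-b+not-b true  = refl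
      toℕ-b+not-b false = refl

      pointwise : (p : ℕ → Bool) (y : ℕ) → y ≤ N →
        toℕ (h y ∧ p y) + toℕ (h (N ∸ y) ∧ p y) + (if does (y ≟ K) then toℕ (p y) else 0) ≡ toℕ (p y)
      pointwise p y y≤N with y ≟ K
      ... | yes refl rewrite dec-true (K ≟ K) refl | m+n∸n≡m K K | h-K with p K
      ...   | true  = refl
      ...   | false = refl
      pointwise p y y≤N | no y≢K rewrite dec-false (y ≟ K) y≢K | h-reflect y≤N y≢K with p y
      ...   | false = trans (cong₂ (λ a b → toℕ a + toℕ b + 0) (∧-zeroʳ (h y)) (∧-zeroʳ (not (h y)))) refl
      ...   | true  = trans (cong₂ (λ a b → toℕ a + toℕ b + 0) (∧-identityʳ (h y)) (∧-identityʳ (not (h y))))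
                            (trans (+-identityʳ _) (toℕ-b+not-b (h y)))

    -- Each y ≠ K in the class p is counted exactly once, through y itself or through its mirror 2K − y;
    -- y = K is counted by the last summand.
    count-mirror : (p : ℕ → Bool) → count (λ y → h y ∧ p y) (suc N) + count (λ y → h y ∧ p (N ∸ y)) (suc N) + toℕ (p K)
                       ≡ count p (suc N)
    count-mirror p = begin
      count (λ y → h y ∧ p y) (suc N) + count (λ y → h y ∧ p (N ∸ y)) (suc N) + toℕ (p K)
        ≡⟨ cong₂ (λ a b → count (λ y → h y ∧ p y) (suc N) + a + b) mirrored
                 (sym (sumBelow-indicator (toℕ ∘ p) (s≤s (m≤m+n K K)))) ⟩
      sumBelow bead (suc N) + sumBelow mirror (suc N) + sumBelow centre (suc N)
        ≡⟨ cong (_+ sumBelow centre (suc N)) (sumBelow-+ bead mirror (suc N)) ⟩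
      sumBelow (λ y → bead y + mirror y) (suc N) + sumBelow centre (suc N)
        ≡⟨ sumBelow-+ (λ y → bead y + mirror y) centre (suc N) ⟩
      sumBelow (λ y → bead y + mirror y + centre y) (suc N)
        ≡⟨ sumBelow-cong (suc N) (λ y y<N → pointwise p y (≤-pred y<N)) ⟩
      count p (suc N) ∎
      where
      open ≡-Reasoning
      bead mirror centre : ℕ → ℕ
      bead   y = toℕ (h y ∧ p y)
      mirror y = toℕ (h (N ∸ y) ∧ p y)
      centre y = if y ≡ᵇ K then toℕ (p y) else 0
      mirrored : count (λ y → h y ∧ p (N ∸ y)) (suc N) ≡ sumBelow mirror (suc N)
      mirrored = trans (sumBelow-reverse (λ y → toℕ (h y ∧ p (N ∸ y))) (suc N))
                       (sumBelow-cong (suc N) (λ y y<N → cong (λ z → toℕ (h (N ∸ y) ∧ p z)) (m∸[m∸n]≡n (≤-pred y<N))))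

  module _ (d : ℕ) .{{_ : NonZero d}} where

    toℕ-if : ∀ b → toℕ b ≡ (if b then 1 else 0)
    toℕ-if true  = refl
    toℕ-if false = refl

    count-residue-class : ∀ n {i} → i < d → count (λ y → y % d ≡ᵇ i) (n * d) ≡ n
    count-residue-class zero    i<d = refl
    count-residue-class (suc n) {i} i<d = begin
      count (λ y → y % d ≡ᵇ i) (d + n * d)
        ≡⟨ sumBelow-split _ d (n * d) ⟩
      count (λ y → y % d ≡ᵇ i) d + count (λ y → (d + y) % d ≡ᵇ i) (n * d)
        ≡⟨ cong₂ _+_ first-block (count-cong (n * d) (λ y _ → cong (_≡ᵇ i) (shift y))) ⟩
      1 + count (λ y → y % d ≡ᵇ i) (n * d)
        ≡⟨ cong suc (count-residue-class n i<d) ⟩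
      suc n ∎
      where
      open ≡-Reasoning
      shift : ∀ y → (d + y) % d ≡ y % d
      shift y = trans (cong (_% d) (+-comm d y)) ([m+n]%n≡m%n y d)
      first-block : count (λ y → y % d ≡ᵇ i) d ≡ 1
      first-block = trans (sumBelow-cong d (λ y y<d → trans (cong (λ z → toℕ (z ≡ᵇ i)) (m<n⇒m%n≡m y<d)) (toℕ-if (y ≡ᵇ i))))
                          (sumBelow-indicator (λ _ → 1) i<d)

    count-residue-class-suc : ∀ n {i} → i < d → count (λ y → y % d ≡ᵇ i) (suc (n * d)) ≡ n + toℕ (0 ≡ᵇ i)
    count-residue-class-suc n {i} i<d = trans (sumBelow-suc _ (n * d))
      (cong₂ _+_ (count-residue-class n i<d) (cong (λ z → toℕ (z ≡ᵇ i)) (m*n%n≡0 n d)))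

    %-complement-unique : ∀ u {x x'} → x < d → x' < d → (u + x) % d ≡ 0 → (u + x') % d ≡ 0 → x ≡ x'
    %-complement-unique u {x} {x'} x<d x'<d ux≡0 ux'≡0 = begin
      x                  ≡⟨ sym (m<n⇒m%n≡m x<d) ⟩
      x % d              ≡⟨ sym (%-remove-+ʳ x (m%n≡0⇒n∣m (u + x') d ux'≡0)) ⟩
      (x + (u + x')) % d ≡⟨ cong (_% d) (x∙yz≈z∙yx x u x') ⟩
      (x' + (u + x)) % d ≡⟨ %-remove-+ʳ x' (m%n≡0⇒n∣m (u + x) d ux≡0) ⟩
      x' % d             ≡⟨ m<n⇒m%n≡m x'<d ⟩
      x'                 ∎
      where open ≡-Reasoning

    %-reflect : ∀ {N y i j} → N % d ≡ 0 → y ≤ N → i < d → j < d → (i + j) % d ≡ 0 →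
                ((N ∸ y) % d ≡ᵇ j) ≡ (y % d ≡ᵇ i)
    %-reflect {N} {y} {i} {j} N≡0 y≤N i<d j<d i+j≡0 =
      does-⇔ (mk⇔ to from) ((N ∸ y) % d ≟ j) (y % d ≟ i)
      where
      sum≡0 : ((N ∸ y) % d + y % d) % d ≡ 0
      sum≡0 = trans (sym (%-distribˡ-+ (N ∸ y) y d)) (trans (cong (_% d) (m∸n+n≡m y≤N)) N≡0)
      to : (N ∸ y) % d ≡ j → y % d ≡ i
      to refl = %-complement-unique ((N ∸ y) % d) (m%n<n y d) i<d sum≡0 (trans (cong (_% d) (+-comm j i)) i+j≡0)
      from : y % d ≡ i → (N ∸ y) % d ≡ j
      from refl = %-complement-unique (y % d) (m%n<n (N ∸ y) d) j<d
                    (trans (cong (_% d) (+-comm (y % d) _)) sum≡0) i+j≡0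

    suc+pred-% : ∀ x y → (suc x + (y + (d ∸ 1))) % d ≡ (x + y) % d
    suc+pred-% x y = begin
      (suc x + (y + (d ∸ 1))) % d ≡⟨ cong (λ z → suc z % d) (sym (+-assoc x y (d ∸ 1))) ⟩
      suc (x + y + (d ∸ 1)) % d   ≡⟨ cong (_% d) (sym (+-suc (x + y) (d ∸ 1))) ⟩
      (x + y + suc (d ∸ 1)) % d   ≡⟨ cong (λ z → (x + y + z) % d) (m+[n∸m]≡n (>-nonZero⁻¹ d)) ⟩
      (x + y + d) % d             ≡⟨ [m+n]%n≡m%n (x + y) d ⟩
      (x + y) % d                 ∎
      where open ≡-Reasoning

  ≤⌈/⌉* : ∀ n d .{{_ : NonZero d}} → n ≤ ((n + (d ∸ 1)) / d) * d
  ≤⌈/⌉* n d = +-cancelʳ-≤ (d ∸ 1) n _ (begin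
    n + (d ∸ 1)                                 ≡⟨ m≡m%n+[m/n]*n (n + (d ∸ 1)) d ⟩
    (n + (d ∸ 1)) % d + ((n + (d ∸ 1)) / d) * d ≤⟨ +-monoˡ-≤ _ (<⇒≤pred (m%n<n (n + (d ∸ 1)) d)) ⟩
    (d ∸ 1) + ((n + (d ∸ 1)) / d) * d           ≡⟨ +-comm (d ∸ 1) _ ⟩
    ((n + (d ∸ 1)) / d) * d + (d ∸ 1)           ∎)
    where open ≤-Reasoning

  -- Bar partitions and the diagram D(μ)

  nth+index-antitone : ∀ {μ} → Decreasing μ → ∀ {c c'} → 1 ≤ c → c ≤ c' → c' ≤ length μ →
                       nth μ c' + c' ≤ nth μ c + c
  nth+index-antitone {x ∷ xs} _ {suc zero} {suc zero} _ _ _ = ≤-refl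
  nth+index-antitone {x ∷ y ∷ xs} (x>y ∷ dec) {suc zero} {suc (suc c')} _ _ (s≤s c'≤) = begin
    nth (y ∷ xs) (suc c') + suc (suc c') ≡⟨ +-suc _ (suc c') ⟩
    suc (nth (y ∷ xs) (suc c') + suc c') ≤⟨ s≤s (nth+index-antitone dec ≤-refl (s≤s z≤n) c'≤) ⟩
    suc (y + 1)                          ≡⟨ cong suc (+-comm y 1) ⟩
    suc (suc y)                          ≤⟨ s≤s x>y ⟩
    suc x                                ≡⟨ +-comm 1 x ⟩
    x + 1                                ∎
    where open ≤-Reasoning
  nth+index-antitone {x ∷ xs} dec {suc (suc c)} {suc (suc c')} _ (s≤s c≤c') (s≤s c'≤) =
    subst₂ _≤_ (sym (+-suc _ (suc c'))) (sym (+-suc _ (suc c)))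
           (s≤s (nth+index-antitone (Decreasing-tail dec) (s≤s z≤n) c≤c' c'≤))

  nth-pos : ∀ {μ} → All (0 <_) μ → ∀ {c} → 1 ≤ c → c ≤ length μ → 0 < nth μ c
  nth-pos (p ∷ _)  {suc zero}    _ _        = p
  nth-pos (_ ∷ ps) {suc (suc c)} _ (s≤s c≤) = nth-pos ps (s≤s z≤n) c≤

  length≤head : ∀ {μ} → IsBar μ → length μ ≤ nth μ 1
  length≤head {[]}    _           = z≤n
  length≤head {x ∷ xs} (dec , pos) = +-cancelʳ-≤ 1 _ _ (begin
    ℓ + 1                     ≡⟨ +-comm ℓ 1 ⟩
    1 + ℓ                     ≤⟨ +-monoˡ-≤ ℓ (nth-pos pos {ℓ} (s≤s z≤n) ≤-refl) ⟩
    nth (x ∷ xs) ℓ + ℓ        ≤⟨ nth+index-antitone dec ≤-refl (s≤s z≤n) ≤-refl ⟩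
    x + 1                     ∎)
    where
    open ≤-Reasoning
    ℓ = length (x ∷ xs)

  head>0⇒nonempty : ∀ {μ} → 0 < nth μ 1 → 0 < length μ
  head>0⇒nonempty {_ ∷ _} _ = z<s

  +-suc-∸1 : ∀ x y → x + suc y ∸ 1 ≡ x + y
  +-suc-∸1 x y = cong (_∸ 1) (+-suc x y)

  double-injective : ∀ {m n} → m + m ≡ n + n → m ≡ n
  double-injective {m} {n} eq = *-cancelˡ-≡ m n 2 (begin
    2 * m ≡⟨ cong (m +_) (+-identityʳ m) ⟩
    m + m ≡⟨ eq ⟩
    n + n ≡⟨ cong (n +_) (sym (+-identityʳ n)) ⟩
    2 * n ∎)
    where open ≡-Reasoning

  module DShape {μ : List ℕ} (μ-bar : IsBar μ) where

    private
      dec = proj₁ μ-bar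
      pos = proj₂ μ-bar

    m A : ℕ
    m = length μ
    A = nth μ 1

    ν : List ℕ
    ν = D μ

    part+index≤A+1 : ∀ {c} → 1 ≤ c → c ≤ m → nth μ c + c ≤ A + 1
    part+index≤A+1 1≤c c≤m = nth+index-antitone dec ≤-refl 1≤c c≤m

    part-pos : ∀ {c} → 1 ≤ c → c ≤ m → 0 < nth μ c
    part-pos = nth-pos pos

    part≤A : ∀ {c} → 1 ≤ c → c ≤ m → nth μ c ≤ A
    part≤A {c} 1≤c c≤m = +-cancelʳ-≤ 1 _ _ (≤-trans (+-monoʳ-≤ (nth μ c) 1≤c) (part+index≤A+1 1≤c c≤m))

    m≤A : m ≤ A
    m≤A = length≤head μ-bar

    -- The row function of `D` is local to its definition; `nth-D refl` lets Agda infer it.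
    nth-D : ∀ {row} → D μ ≡ map row (range1 A) → ∀ {s} → s < A → nth ν (suc s) ≡ row (suc s)
    nth-D {row} eq {s} s<A = trans (cong (λ xs → nth xs (suc s)) eq) (nth-map-range1 row A s<A)

    tallColumns : ℕ → ℕ
    tallColumns s = count (λ y → s ≤ᵇ nth μ (suc y) + suc y ∸ 1) m

    row-≤m : ∀ {s} → suc s ≤ m → nth ν (suc s) ≡ nth μ (suc s) + suc s
    row-≤m {s} s<m with suc s ≤? m | nth-D refl {s} (≤-trans s<m m≤A)
    ... | yes _    | eq = eq
    ... | no  s≰m  | _  = ⊥-elim (s≰m s<m)

    row->m : ∀ {s} → m < suc s → suc s ≤ A → nth ν (suc s) ≡ tallColumns (suc s)
    row->m {s} m<s s≤A with suc s ≤? m | nth-D refl {s} s≤A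
    ... | yes s≤m | _  = ⊥-elim (<⇒≱ m<s s≤m)
    ... | no  _   | eq = trans eq (length-filter-range1 (λ c → suc s ≤? nth μ c + c ∸ 1) m)

    row->A : ∀ {s} → A < s → nth ν s ≡ 0
    row->A A<s = nth-out ν (subst (_< _) (sym (length-map-range1 _ A)) A<s)

    tallColumns-initial : ∀ s {y} → y < m → (s ≤ᵇ nth μ (suc y) + suc y ∸ 1) ≡ (y <ᵇ tallColumns s)
    tallColumns-initial s = count-initial m closed
      where
      closed : DownClosed (λ y → s ≤ᵇ nth μ (suc y) + suc y ∸ 1) m
      closed {y} {y'} y≤y' y'<m s≤ = ≤⇒≤ᵇ (≤-trans (≤ᵇ⇒≤ s _ s≤)
        (∸-monoˡ-≤ 1 (nth+index-antitone dec (s≤s z≤n) (s≤s y≤y') y'<m)))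

    rows-antitone : ∀ s → nth ν (suc (suc s)) ≤ nth ν (suc s)
    rows-antitone s with suc (suc s) ≤? m | suc (suc s) ≤? A | suc s ≤? m
    ... | yes s+1<m | _ | _ =
      subst₂ _≤_ (sym (row-≤m s+1<m)) (sym (row-≤m (≤-trans (n≤1+n _) s+1<m)))
             (nth+index-antitone dec (s≤s z≤n) (n≤1+n _) s+1<m)
    ... | no _ | no s+1≮A | _ = subst (_≤ nth ν (suc s)) (sym (row->A (≰⇒> s+1≮A))) z≤n
    ... | no s+1≮m | yes s+1<A | yes s<m =
      subst₂ _≤_ (sym (row->m (≰⇒> s+1≮m) s+1<A)) (sym (row-≤m s<m))
             (≤-trans (count≤ _ m) (≤-trans (≤-pred (≰⇒> s+1≮m)) (m≤n+m (suc s) _)))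
    ... | no s+1≮m | yes s+1<A | no s≮m =
      subst₂ _≤_ (sym (row->m (≰⇒> s+1≮m) s+1<A)) (sym (row->m (≰⇒> s≮m) (≤-trans (n≤1+n _) s+1<A)))
             (count-mono m (λ y _ s+2≤ → ≤⇒≤ᵇ (≤-trans (n≤1+n _) (≤ᵇ⇒≤ (suc (suc s)) (nth μ (suc y) + suc y ∸ 1) s+2≤))))

    row-pos : ∀ {s} → s < A → 0 < nth ν (suc s)
    row-pos {s} s<A with suc s ≤? m
    ... | yes s<m = subst (0 <_) (sym (row-≤m s<m)) (≤-trans (s≤s z≤n) (m≤n+m (suc s) _))
    ... | no  s≮m = subst (0 <_) (sym (row->m (≰⇒> s≮m) s<A))
                      (count-pos m (≤⇒≤ᵇ (subst (suc s ≤_) (sym (m+n∸n≡m A 1)) s<A)) (head>0⇒nonempty {μ} (≤-<-trans z≤n s<A)))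

    length-filter-D : ∀ {ℓ} {P : Pred ℕ ℓ} (P? : Decidable P) → length (filter P? ν) ≡ count (λ x → does (P? (nth ν (suc x)))) A
    length-filter-D P? = length-filter-map-range1-nth P? _ A

    numParts-D : numParts ν ≡ A
    numParts-D = trans (length-filter-D (0 <?_))
      (trans (count-cong A (λ x x<A → trans (dec-true (0 <? nth ν (suc x)) (row-pos x<A)) (sym (dec-true (x <? A) x<A))))
             (count-<ᵇ ≤-refl))

    colLen-D : ∀ c → colLen ν c ≡ count (λ x → c ≤ᵇ nth ν (suc x)) A
    colLen-D c = length-filter-D (c ≤?_)

    m<part+index : ∀ {c} → 1 ≤ c → c ≤ m → m < nth μ c + c
    m<part+index {c} 1≤c c≤m = begin-strict
      m              <⟨ m<n+m m (part-pos {m} (≤-trans 1≤c c≤m) ≤-refl) ⟩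
      nth μ m + m    ≤⟨ nth+index-antitone dec 1≤c c≤m ≤-refl ⟩
      nth μ c + c    ∎
      where open ≤-Reasoning

    colLen-D-m+1 : colLen ν (m + 1) ≡ m
    colLen-D-m+1 = trans (cong (colLen ν) (+-comm m 1))
                         (trans (colLen-D (suc m)) (trans (count-cong A long-row) (count-<ᵇ m≤A)))
      where
      long-row : ∀ x → x < A → (suc m ≤ᵇ nth ν (suc x)) ≡ (x <ᵇ m)
      long-row x x<A with suc x ≤? m
      ... | yes x<m = trans (dec-true (suc m ≤? _) (subst (m <_) (sym (row-≤m x<m)) (m<part+index (s≤s z≤n) x<m)))
                            (sym (dec-true (x <? m) x<m))
      ... | no  x≮m = trans (dec-false (suc m ≤? _) (<⇒≱ (subst (_< suc m) (sym (row->m (≰⇒> x≮m) x<A)) (s≤s (count≤ _ m)))))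
                            (sym (dec-false (x <? m) x≮m))

    colLen-D-≤m : ∀ {r} → suc r ≤ m → colLen ν (suc r) ≡ nth μ (suc r) + r
    colLen-D-≤m {r} r<m = trans (colLen-D (suc r)) (trans (count-cong A long-row) (count-<ᵇ col≤A))
      where
      m≤col : m ≤ nth μ (suc r) + r
      m≤col = ≤-pred (subst (m <_) (+-suc _ r) (m<part+index (s≤s z≤n) r<m))
      col≤A : nth μ (suc r) + r ≤ A
      col≤A = +-cancelʳ-≤ 1 _ _ (subst (_≤ A + 1) (trans (+-suc _ r) (+-comm 1 _)) (part+index≤A+1 (s≤s z≤n) r<m))
      long-row : ∀ x → x < A → (suc r ≤ᵇ nth ν (suc x)) ≡ (x <ᵇ nth μ (suc r) + r)
      long-row x x<A with suc x ≤? m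
      ... | yes x<m = trans (dec-true (suc r ≤? _) (subst (suc r ≤_) (sym (row-≤m x<m))
                              (≤-trans (≤-trans r<m (n≤1+n m)) (m<part+index (s≤s z≤n) x<m))))
                            (sym (dec-true (x <? _) (≤-trans x<m m≤col)))
      ... | no  x≮m = trans (cong (suc r ≤ᵇ_) (row->m (≰⇒> x≮m) x<A))
                            (trans (sym (tallColumns-initial (suc x) r<m)) (cong (suc x ≤ᵇ_) (+-suc-∸1 (nth μ (suc r)) r)))

    isPart : ℕ → Bool
    isPart x = does (x ∈? μ)

    part∉>A : ∀ {j} → A < j → isPart j ≡ false
    part∉>A A<j = dec-false (_ ∈? μ) λ j∈μ → let (c , 1≤c , c≤m , eq) = ∈⇒nth μ j∈μ
                                              in <⇒≱ A<j (subst (_≤ A) eq (part≤A 1≤c c≤m))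

    -- Were s − p the part a_c, column c would reach row s iff c > p, whereas exactly the first p columns do.
    gap∉ : ∀ {s} → m < s → isPart (s ∸ tallColumns s) ≡ false
    gap∉ {s} m<s = dec-false (_ ∈? μ) λ t∈μ → let (c , 1≤c , c≤m , eq) = ∈⇒nth μ t∈μ in contra c 1≤c c≤m eq
      where
      p = tallColumns s
      t = s ∸ p
      s≡p+t : s ≡ p + t
      s≡p+t = sym (m+[n∸m]≡n (≤-trans (count≤ _ m) (<⇒≤ m<s)))
      contra : ∀ c → 1 ≤ c → c ≤ m → nth μ c ≡ t → ⊥
      contra (suc c') _ c≤m eq = not-¬ refl (begin
        c' <ᵇ p                          ≡⟨ sym (tallColumns-initial s c≤m) ⟩
        s ≤ᵇ nth μ (suc c') + suc c' ∸ 1 ≡⟨ cong₂ _≤ᵇ_ s≡p+t (trans (+-suc-∸1 _ c') (cong (_+ c') eq)) ⟩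
        p + t ≤ᵇ t + c'                  ≡⟨ does-⇔ (mk⇔ cancel shift) (p + t ≤? t + c') (p ≤? c') ⟩
        p ≤ᵇ c'                          ≡⟨ does-⇔ (mk⇔ ≤⇒≯ ≮⇒≥) (p ≤? c') (¬? (c' <? p)) ⟩
        not (c' <ᵇ p)                    ∎)
        where
        open ≡-Reasoning
        cancel : p + t ≤ t + c' → p ≤ c'
        cancel h = +-cancelʳ-≤ t p c' (subst (p + t ≤_) (+-comm t c') h)
        shift : p ≤ c' → p + t ≤ t + c'
        shift h = subst (p + t ≤_) (+-comm c' t) (+-monoˡ-≤ t h)

    row>m≤m : ∀ {s} → m < s → nth ν s ≤ m
    row>m≤m {suc s} m<s with suc s ≤? A
    ... | yes s<A = subst (_≤ m) (sym (row->m m<s s<A)) (count≤ _ m)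
    ... | no  s≮A = subst (_≤ m) (sym (row->A (≰⇒> s≮A))) z≤n

    hole∉ : ∀ {s} → m < s → isPart (s ∸ nth ν s) ≡ false
    hole∉ {suc s} m<s with suc s ≤? A
    ... | yes s<A rewrite row->m m<s s<A = gap∉ m<s
    ... | no  s≮A rewrite row->A (≰⇒> s≮A) = part∉>A (≰⇒> s≮A)

    hookLen-diagonal : ∀ {r} → 1 ≤ r → r ≤ m → hookLen ν r r ≡ nth μ r + nth μ r
    hookLen-diagonal {suc r'} 1≤r r≤m rewrite row-≤m r≤m | colLen-D-≤m r≤m =
      arith (nth μ (suc r')) (part-pos 1≤r r≤m)
      where
      arith : ∀ b → 0 < b → (b + suc r' ∸ suc r') + (b + r' ∸ suc r') + 1 ≡ b + b
      arith (suc b') _ rewrite m+n∸n≡m (suc b') (suc r') | m+n∸n≡m b' r' =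
        trans (+-assoc (suc b') b' 1) (cong (suc b' +_) (+-comm b' 1))

    hookLen-beyond-legs : ∀ {r} → 1 ≤ r → r ≤ m → hookLen ν r (m + 1) ≡ nth μ r
    hookLen-beyond-legs {suc r'} 1≤r r≤m = begin
      (nth ν r ∸ (m + 1)) + (colLen ν (m + 1) ∸ r) + 1
        ≡⟨ cong₂ (λ x y → (x ∸ (m + 1)) + (y ∸ r) + 1) (row-≤m r≤m) colLen-D-m+1 ⟩
      (b + r ∸ (m + 1)) + (m ∸ r) + 1     ≡⟨ +-assoc (b + r ∸ (m + 1)) (m ∸ r) 1 ⟩
      (b + r ∸ (m + 1)) + ((m ∸ r) + 1)   ≡⟨ cong ((b + r ∸ (m + 1)) +_) (sym (+-∸-comm 1 r≤m)) ⟩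
      (b + r ∸ (m + 1)) + (m + 1 ∸ r)     ≡⟨ sym (+-∸-assoc (b + r ∸ (m + 1)) (≤-trans r≤m (m≤m+n m 1))) ⟩
      (b + r ∸ (m + 1)) + (m + 1) ∸ r     ≡⟨ cong (_∸ r) (m∸n+n≡m (subst (_≤ b + r) (+-comm 1 m) (m<part+index 1≤r r≤m))) ⟩
      b + r ∸ r                           ≡⟨ m+n∸n≡m b r ⟩
      b                                   ∎
      where
      open ≡-Reasoning
      r = suc r'
      b = nth μ r

    module Beads (K : ℕ) (A≤K : A ≤ K) where

      β : ℕ → ℕ
      β s = nth ν s + K ∸ s

      -- The abacus of D(μ) with K beads: a bead at K + a for each part a, and at K − j for each j ≥ 1 not a part.
      bead : ℕ → Bool
      bead y = if K <ᵇ y then isPart (y ∸ K) else if y <ᵇ K then not (isPart (K ∸ y)) else false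

      bead-above : ∀ {y} → K < y → bead y ≡ isPart (y ∸ K)
      bead-above {y} K<y rewrite dec-true (K <? y) K<y = refl

      bead-below : ∀ {y} → y < K → bead y ≡ not (isPart (K ∸ y))
      bead-below {y} y<K rewrite dec-false (K <? y) (<⇒≯ y<K) | dec-true (y <? K) y<K = refl

      bead-K : bead K ≡ false
      bead-K rewrite dec-false (K <? K) (<-irrefl refl) = refl

      bead-reflect : ∀ {y} → y ≤ K + K → y ≢ K → bead (K + K ∸ y) ≡ not (bead y)
      bead-reflect {y} y≤2K y≢K with <-cmp y K
      ... | tri≈ _ y≡K _ = ⊥-elim (y≢K y≡K)
      ... | tri< y<K _ _ = begin
        bead (K + K ∸ y)          ≡⟨ cong bead (+-∸-assoc K (<⇒≤ y<K)) ⟩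
        bead (K + (K ∸ y))        ≡⟨ bead-above (m<m+n K (m<n⇒0<n∸m y<K)) ⟩
        isPart (K + (K ∸ y) ∸ K)  ≡⟨ cong isPart (m+n∸m≡n K _) ⟩
        isPart (K ∸ y)            ≡⟨ sym (not-involutive _) ⟩
        not (not (isPart (K ∸ y))) ≡⟨ cong not (sym (bead-below y<K)) ⟩
        not (bead y)              ∎
        where open ≡-Reasoning
      ... | tri> _ _ K<y = begin
        bead (K + K ∸ y)               ≡⟨ bead-below mirror<K ⟩
        not (isPart (K ∸ (K + K ∸ y))) ≡⟨ cong (not ∘ isPart) K∸mirror ⟩
        not (isPart (y ∸ K))           ≡⟨ cong not (sym (bead-above K<y)) ⟩
        not (bead y)                   ∎
        where
        open ≡-Reasoning
        mirror<K : K + K ∸ y < K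
        mirror<K = subst (K + K ∸ y <_) (m+n∸n≡m K K) (∸-monoʳ-< K<y y≤2K)
        t = y ∸ K
        y≡K+t : y ≡ K + t
        y≡K+t = sym (m+[n∸m]≡n (<⇒≤ K<y))
        K∸mirror : K ∸ (K + K ∸ y) ≡ t
        K∸mirror = begin
          K ∸ (K + K ∸ y)       ≡⟨ cong (λ z → K ∸ (K + K ∸ z)) y≡K+t ⟩
          K ∸ (K + K ∸ (K + t)) ≡⟨ cong (K ∸_) ([m+n]∸[m+o]≡n∸o K K t) ⟩
          K ∸ (K ∸ t)           ≡⟨ m∸[m∸n]≡n (+-cancelˡ-≤ K t K (subst (_≤ K + K) y≡K+t y≤2K)) ⟩
          t                     ∎

      β-≤m : ∀ {s} → s ≤ m → 1 ≤ s → β s ≡ nth μ s + K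
      β-≤m {suc s} s≤m _ = begin
        nth ν (suc s) + K ∸ suc s         ≡⟨ cong (λ z → z + K ∸ suc s) (row-≤m s≤m) ⟩
        nth μ (suc s) + suc s + K ∸ suc s ≡⟨ cong (_∸ suc s) (xy∙z≈xz∙y (nth μ (suc s)) (suc s) K) ⟩
        nth μ (suc s) + K + suc s ∸ suc s ≡⟨ m+n∸n≡m _ (suc s) ⟩
        nth μ (suc s) + K                 ∎
        where open ≡-Reasoning

      β->m : ∀ {s} → m < s → s ≤ K → β s ≡ K ∸ (s ∸ nth ν s)
      β->m {s} m<s s≤K = begin
        nth ν s + K ∸ s              ≡⟨ cong (λ z → r + K ∸ z) (sym (m+[n∸m]≡n r≤s)) ⟩
        r + K ∸ (r + (s ∸ r))        ≡⟨ [m+n]∸[m+o]≡n∸o r K (s ∸ r) ⟩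
        K ∸ (s ∸ r)                  ∎
        where
        open ≡-Reasoning
        r = nth ν s
        r≤s : r ≤ s
        r≤s = ≤-trans (row>m≤m m<s) (<⇒≤ m<s)

      β-bead : ∀ {x} → x < K → β (suc x) ≤ K + K × T (bead (β (suc x)))
      β-bead {x} x<K with suc x ≤? m
      ... | yes x<m rewrite β-≤m x<m (s≤s z≤n) =
        +-monoˡ-≤ K (≤-trans (part≤A (s≤s z≤n) x<m) A≤K) ,
        ≡true⇒T (trans (bead-above (m<n+m K (part-pos (s≤s z≤n) x<m)))
                       (trans (cong isPart (m+n∸n≡m _ K)) (dec-true (_ ∈? μ) (nth∈ μ (s≤s z≤n) x<m))))
      ... | no  x≮m rewrite β->m (≰⇒> x≮m) x<K =
        ≤-trans (m∸n≤m K j) (m≤m+n K K) ,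
        ≡true⇒T (trans (bead-below (∸-monoʳ-< 0<j j≤K))
                       (trans (cong (not ∘ isPart) (m∸[m∸n]≡n j≤K)) (cong not (hole∉ (≰⇒> x≮m)))))
        where
        j = suc x ∸ nth ν (suc x)
        j≤K : j ≤ K
        j≤K = ≤-trans (m∸n≤m (suc x) (nth ν (suc x))) x<K
        0<j : 0 < j
        0<j = m<n⇒0<n∸m (≤-<-trans (row>m≤m (≰⇒> x≮m)) (≰⇒> x≮m))

      β-decreasing : ∀ {s} → suc s < K → β (suc (suc s)) < β (suc s)
      β-decreasing {s} s+1<K = begin-strict
        nth ν (suc (suc s)) + K ∸ suc (suc s) ≤⟨ ∸-monoˡ-≤ (suc (suc s)) (+-monoˡ-≤ K (rows-antitone s)) ⟩
        nth ν (suc s) + K ∸ suc (suc s)       <⟨ ∸-monoʳ-< ≤-refl (≤-trans s+1<K (m≤n+m K (nth ν (suc s)))) ⟩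
        nth ν (suc s) + K ∸ suc s             ∎
        where open ≤-Reasoning

      betas : List ℕ
      betas = map β (range1 K)

      beads-list : List ℕ
      beads-list = filter (λ y → T? (bead y)) (downFrom (suc (K + K)))

      betas-Decreasing : Decreasing betas
      betas-Decreasing rewrite sym (map-∘ {g = β} {f = suc} (upTo K)) | map-upTo (β ∘ suc) K =
        applyUpTo⁺₁ (β ∘ suc) K β-decreasing

      beads-list-Decreasing : Decreasing beads-list
      beads-list-Decreasing = filter⁺ (λ y → T? (bead y)) (λ y>z z>w → <-trans z>w y>z)
                                      (applyDownFrom⁺₂ id (suc (K + K)) (λ _ → ≤-refl))

      betas⊆beads-list : ∀ {z} → z ∈ betas → z ∈ beads-list
      betas⊆beads-list z∈ with ∈-map⁻ β z∈
      ... | s , s∈ , refl with ∈-map⁻ suc s∈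
      ...   | x , x∈ , refl = let (≤2K , is-bead) = β-bead (∈-upTo⁻ x∈) in
        ∈-filter⁺ (λ y → T? (bead y)) (∈-downFrom⁺ (s≤s ≤2K)) is-bead

      count-bead : count bead (suc (K + K)) ≡ K
      count-bead = double-injective (+-cancelʳ-≡ 1 _ _ (begin
        count bead (suc (K + K)) + count bead (suc (K + K)) + 1
          ≡⟨ cong (λ c → c + c + 1) (count-cong (suc (K + K)) (λ y _ → sym (∧-identityʳ (bead y)))) ⟩
        count (λ y → bead y ∧ true) (suc (K + K)) + count (λ y → bead y ∧ true) (suc (K + K)) + 1
          ≡⟨ count-mirror K bead bead-K bead-reflect (λ _ → true) ⟩
        count (λ _ → true) (suc (K + K))
          ≡⟨ count-cong (suc (K + K)) (λ y y<2K+1 → sym (dec-true (y <? suc (K + K)) y<2K+1)) ⟩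
        count (_<ᵇ suc (K + K)) (suc (K + K))
          ≡⟨ count-<ᵇ ≤-refl ⟩
        suc (K + K)
          ≡⟨ +-comm 1 (K + K) ⟩
        K + K + 1 ∎))
        where open ≡-Reasoning

      betas≡beads-list : betas ≡ beads-list
      betas≡beads-list = Decreasing-⊆-length⇒≡ betas-Decreasing beads-list-Decreasing betas⊆beads-list
        (trans (length-map-range1 β K)
               (sym (trans (length-filter-downFrom (λ y → T? (bead y)) (suc (K + K))) count-bead)))

  beads-D-mirror : ∀ d .{{_ : NonZero d}} {μ} → IsBar μ → ∀ {i j} → i < d → j < d → (i + j) % d ≡ 0 →
                   beads d (D μ) i + beads d (D μ) j ≡ beads d (D μ) 0 + beads d (D μ) 0
  beads-D-mirror d {μ} μ-bar i<d j<d i+j≡0 =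
    trans (runner-pair i<d j<d i+j≡0) (sym (runner-pair 0<d 0<d (m*n%n≡0 0 d)))
    where
    open DShape μ-bar
    q = (numParts ν + (d ∸ 1)) / d
    K = q * d
    open Beads K (subst (_≤ K) numParts-D (≤⌈/⌉* (numParts ν) d))
    N = K + K
    0<d : 0 < d
    0<d = >-nonZero⁻¹ d
    residue : ℕ → ℕ → Bool
    residue i y = y % d ≡ᵇ i
    beads-count : ∀ i → beads d ν i ≡ count (λ y → bead y ∧ residue i y) (suc N)
    beads-count i = begin
      length (filter runner? betas)                       ≡⟨ cong (length ∘ filter runner?) betas≡beads-list ⟩
      length (filter runner? beads-list)                  ≡⟨ length-filter-filter runner? bead? (downFrom (suc N)) ⟩
      length (filter (λ y → bead? y ×-dec runner? y) (downFrom (suc N)))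
        ≡⟨ length-filter-downFrom (λ y → bead? y ×-dec runner? y) (suc N) ⟩
      count (λ y → bead y ∧ residue i y) (suc N)          ∎
      where
      open ≡-Reasoning
      runner? = λ x → x % d ≟ i
      bead? = λ y → T? (bead y)
    runner-pair : ∀ {i j} → i < d → j < d → (i + j) % d ≡ 0 → beads d ν i + beads d ν j ≡ q + q
    runner-pair {i} {j} i<d j<d i+j≡0 = +-cancelʳ-≡ (toℕ (residue i K)) _ _ (begin
      beads d ν i + beads d ν j + toℕ (residue i K)
        ≡⟨ cong₂ (λ a b → a + b + toℕ (residue i K)) (beads-count i) (trans (beads-count j) mirrored) ⟩
      count (λ y → bead y ∧ residue i y) (suc N) + count (λ y → bead y ∧ residue i (N ∸ y)) (suc N) + toℕ (residue i K)
        ≡⟨ count-mirror K bead bead-K bead-reflect (residue i) ⟩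
      count (residue i) (suc N)
        ≡⟨ cong (λ n → count (residue i) (suc n)) (sym (*-distribʳ-+ d q q)) ⟩
      count (residue i) (suc ((q + q) * d))
        ≡⟨ count-residue-class-suc d (q + q) i<d ⟩
      q + q + toℕ (0 ≡ᵇ i)
        ≡⟨ cong (λ r → q + q + toℕ (r ≡ᵇ i)) (sym (m*n%n≡0 q d)) ⟩
      q + q + toℕ (residue i K) ∎)
      where
      open ≡-Reasoning
      mirrored : count (λ y → bead y ∧ residue j y) (suc N) ≡ count (λ y → bead y ∧ residue i (N ∸ y)) (suc N)
      mirrored = count-cong (suc N) (λ y y<N → cong (bead y ∧_)
        (sym (%-reflect d (trans (cong (_% d) (sym (*-distribʳ-+ d q q))) (m*n%n≡0 (q + q) d)) (≤-pred y<N) j<d i<d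
               (trans (cong (_% d) (+-comm j i)) i+j≡0))))

module Hooks where

  open import Defs
  open import Data.Integer.Base using (+_; -_; _+_; _-_; _*_; _%ℕ_)
  open import Data.Integer.Properties using (pos-+; [+m]-[+n]≡m⊖n; ⊖-≥; ⊖-≤; +-inverseʳ; +-identityʳ)
  open import Data.Integer.Tactic.RingSolver using (solve-∀)
  open import Data.Integer.DivMod using (n%ℕd<d)
  open import Data.List.Base using (List)
  open import Data.Nat.Base as ℕ using (ℕ; zero; suc; _∸_; _≤_; _<_; NonZero)
  open import Data.Nat.DivMod using (_%_; %-distribˡ-+; m<n⇒m%n≡m; m%n<n; m*n%n≡0; n%n≡0; m%n%n≡m%n)
  import Data.Nat.Properties as ℕ
  open import Function.Base using (_∘_)
  open import Relation.Binary.PropositionalEquality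
  open Doubled using (suc+pred-%; module DShape)

  hookTo : (d : ℕ) .{{_ : NonZero d}} → List ℕ → ℕ → ℕ → ℕ
  hookTo d ν r c = (footRes d ν r c ℕ.+ (d ∸ 1)) % d

  handRes<d : ∀ d .{{_ : NonZero d}} ν r c → handRes d ν r c < d
  handRes<d d ν r c = n%ℕd<d (+ rowLen ν r - + r) d

  +[m+n]-+n≡+m : ∀ m n → + (m ℕ.+ n) - + n ≡ + m
  +[m+n]-+n≡+m m n = trans ([+m]-[+n]≡m⊖n (m ℕ.+ n) n) (trans (⊖-≥ (ℕ.m≤n+m n m)) (cong +_ (ℕ.m+n∸n≡m m n)))

  +n-+[m+n]≡-m : ∀ m n → + n - + (m ℕ.+ n) ≡ - + m
  +n-+[m+n]≡-m m n = trans ([+m]-[+n]≡m⊖n n (m ℕ.+ n)) (trans (⊖-≤ (ℕ.m≤n+m n m)) (cong (-_ ∘ +_) (ℕ.m+n∸n≡m m n)))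

  n+[-n]%ℕ≡0 : ∀ d .{{_ : NonZero d}} n → (n ℕ.+ (- + n) %ℕ d) % d ≡ 0
  n+[-n]%ℕ≡0 d zero = trans (m%n%n≡m%n 0 d) (m*n%n≡0 0 d)
  n+[-n]%ℕ≡0 d (suc n) with suc n % d in eq
  ... | zero   = trans (cong (_% d) (ℕ.+-identityʳ (suc n))) eq
  ... | suc r' = begin
    (suc n ℕ.+ (d ∸ suc r')) % d             ≡⟨ %-distribˡ-+ (suc n) (d ∸ suc r') d ⟩
    (suc n % d ℕ.+ (d ∸ suc r') % d) % d     ≡⟨ cong (λ z → (z ℕ.+ (d ∸ suc r') % d) % d) (trans eq (sym (m<n⇒m%n≡m r<d))) ⟩
    (suc r' % d ℕ.+ (d ∸ suc r') % d) % d    ≡⟨ sym (%-distribˡ-+ (suc r') (d ∸ suc r') d) ⟩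
    (suc r' ℕ.+ (d ∸ suc r')) % d            ≡⟨ cong (_% d) (ℕ.m+[n∸m]≡n (ℕ.<⇒≤ r<d)) ⟩
    d % d                                    ≡⟨ n%n≡0 d ⟩
    0                                        ∎
    where
    open ≡-Reasoning
    r<d : suc r' < d
    r<d = subst (_< d) eq (m%n<n (suc n) d)

  module _ {μ : List ℕ} (μ-bar : IsBar μ) (d : ℕ) .{{_ : NonZero d}} where

    open DShape μ-bar

    handRes-D : ∀ {r} c → 1 ≤ r → r ≤ m → handRes d ν r c ≡ nth μ r % d
    handRes-D {suc r'} c _ r≤m = cong (_%ℕ d) (trans (cong (λ x → + x - + suc r') (row-≤m r≤m)) (+[m+n]-+n≡+m _ (suc r')))

    hookTo-beyond-legs : 1 < d → ∀ r → hookTo d ν r (m ℕ.+ 1) ≡ 0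
    hookTo-beyond-legs 1<d r = begin
      ((+ (m ℕ.+ 1) - + colLen ν (m ℕ.+ 1)) %ℕ d ℕ.+ (d ∸ 1)) % d
        ≡⟨ cong (λ c → ((+ (m ℕ.+ 1) - + c) %ℕ d ℕ.+ (d ∸ 1)) % d) colLen-D-m+1 ⟩
      ((+ (m ℕ.+ 1) - + m) %ℕ d ℕ.+ (d ∸ 1)) % d
        ≡⟨ cong (λ z → (z %ℕ d ℕ.+ (d ∸ 1)) % d) (trans (cong (λ x → + x - + m) (ℕ.+-comm m 1)) (+[m+n]-+n≡+m 1 m)) ⟩
      (1 % d ℕ.+ (d ∸ 1)) % d
        ≡⟨ cong (λ z → (z ℕ.+ (d ∸ 1)) % d) (m<n⇒m%n≡m 1<d) ⟩
      (1 ℕ.+ (0 ℕ.+ (d ∸ 1))) % d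
        ≡⟨ suc+pred-% d 0 0 ⟩
      0 % d
        ≡⟨ m*n%n≡0 0 d ⟩
      0 ∎
      where open ≡-Reasoning

    handRes+hookTo-diagonal : ∀ {r} → 1 ≤ r → r ≤ m → (handRes d ν r r ℕ.+ hookTo d ν r r) % d ≡ 0
    handRes+hookTo-diagonal {suc r'} 1≤r r≤m = begin
      (handRes d ν r r ℕ.+ hookTo d ν r r) % d
        ≡⟨ cong₂ (λ x y → (x ℕ.+ ((+ r - + y) %ℕ d ℕ.+ (d ∸ 1)) % d) % d) (handRes-D r 1≤r r≤m) (colLen-D-≤m r≤m) ⟩
      (nth μ r % d ℕ.+ ((+ r - + (nth μ r ℕ.+ r')) %ℕ d ℕ.+ (d ∸ 1)) % d) % d
        ≡⟨ diagonal (nth μ r) (part-pos 1≤r r≤m) ⟩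
      0 ∎
      where
      open ≡-Reasoning
      r = suc r'
      diagonal : ∀ b → 0 < b → (b % d ℕ.+ ((+ r - + (b ℕ.+ r')) %ℕ d ℕ.+ (d ∸ 1)) % d) % d ≡ 0
      diagonal (suc b') _ = begin
        (suc b' % d ℕ.+ (F ℕ.+ (d ∸ 1)) % d) % d ≡⟨ sym (%-distribˡ-+ (suc b') _ d) ⟩
        (suc b' ℕ.+ (F ℕ.+ (d ∸ 1))) % d        ≡⟨ suc+pred-% d b' F ⟩
        (b' ℕ.+ F) % d                           ≡⟨ cong (λ z → (b' ℕ.+ z %ℕ d) % d) foot ⟩
        (b' ℕ.+ (- + b') %ℕ d) % d               ≡⟨ n+[-n]%ℕ≡0 d b' ⟩
        0 ∎
        where
        F = (+ r - + (suc b' ℕ.+ r')) %ℕ d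
        foot : + r - + (suc b' ℕ.+ r') ≡ - + b'
        foot = trans (cong (λ x → + r - + x) (sym (ℕ.+-suc b' r'))) (+n-+[m+n]≡-m b' r)

  hbar-double : ∀ d .{{_ : NonZero d}} lam ν r c c' →
    hookLen ν r c ≡ hookLen ν r c' ℕ.+ hookLen ν r c' → hookTo d ν r c' ≡ 0 →
    beads d (D lam) (handRes d ν r c') ℕ.+ beads d (D lam) (hookTo d ν r c) ≡ beads d (D lam) 0 ℕ.+ beads d (D lam) 0 →
    hbar d lam ν r c ≡ + 2 * hbar d lam ν r c'
  hbar-double d lam ν r c c' hook≡ to-0 balanced = begin
    + hookLen ν r c + (+ X i - + X j) * + d           ≡⟨ cong (λ h → + h + (+ X i - + X j) * + d) hook≡ ⟩
    + (h ℕ.+ h) + (+ X i - + X j) * + d               ≡⟨ cong (_+ (+ X i - + X j) * + d) (pos-+ h h) ⟩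
    + h + + h + (+ X i - + X j) * + d                 ≡⟨ identity (+ h) (+ X i) (+ X j) (+ X 0) (+ d) ⟩
    + 2 * (+ h + (+ X i - + X 0) * + d) + ((+ X 0 + + X 0) - (+ X i + + X j)) * + d
      ≡⟨ cong (λ z → + 2 * (+ h + (+ X i - + X 0) * + d) + ((+ X 0 + + X 0) - z) * + d) balancedℤ ⟩
    + 2 * (+ h + (+ X i - + X 0) * + d) + ((+ X 0 + + X 0) - (+ X 0 + + X 0)) * + d
      ≡⟨ cong (λ z → + 2 * (+ h + (+ X i - + X 0) * + d) + z * + d) (+-inverseʳ (+ X 0 + + X 0)) ⟩
    + 2 * (+ h + (+ X i - + X 0) * + d) + + 0         ≡⟨ +-identityʳ _ ⟩
    + 2 * (+ h + (+ X i - + X 0) * + d)               ≡⟨ cong (λ k → + 2 * (+ h + (+ X i - + X k) * + d)) (sym to-0) ⟩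
    + 2 * hbar d lam ν r c'                           ∎
    where
    open ≡-Reasoning
    X : ℕ → ℕ
    X = beads d (D lam)
    h = hookLen ν r c'
    i = handRes d ν r c'
    j = hookTo d ν r c
    identity : ∀ B Xi Xj X0 D → B + B + (Xi - Xj) * D ≡ + 2 * (B + (Xi - X0) * D) + ((X0 + X0) - (Xi + Xj)) * D
    identity = solve-∀
    balancedℤ : + X i + + X j ≡ + X 0 + + X 0
    balancedℤ = trans (sym (pos-+ (X i) (X j))) (trans (cong +_ balanced) (pos-+ (X 0) (X 0)))

open import Defs
open import Data.Nat using (ℕ; _≤_; _+_; NonZero)
open import Data.Nat.Divisibility using (_∣_)
open import Data.Integer.Base using (ℤ; +_; _*_)
open import Data.List using (List; []; length)
open import Relation.Binary.PropositionalEquality using (_≡_)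
open import Relation.Nullary using (¬_)
open import Data.Nat.DivMod using (m%n<n)
open import Data.Nat.Properties using (≤-trans; n≤1+n)
open import Relation.Binary.PropositionalEquality using (trans; sym; cong)
open Doubled using (beads-D-mirror; module DShape)
open Hooks

corollary3p5 : (d : ℕ) .{{_ : NonZero d}} → 3 ≤ d → ¬ (2 ∣ d) →
    (lam q : List ℕ) → IsBar lam → IsBar q →
    core d (D q) ≡ [] → quotient d (D q) ≡ quotient d (D lam) →
    (r : ℕ) → 1 ≤ r → r ≤ length q →
    hbar d lam (D q) r r ≡ + 2 * hbar d lam (D q) r (length q + 1)
corollary3p5 d 3≤d _ lam q lam-bar q-bar _ _ r 1≤r r≤t =
  hbar-double d lam (D q) r r (length q + 1)
    (trans (hookLen-diagonal 1≤r r≤t) (cong (λ b → b + b) (sym (hookLen-beyond-legs 1≤r r≤t))))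
    (hookTo-beyond-legs q-bar d (≤-trans (n≤1+n 2) 3≤d) r)
    (beads-D-mirror d lam-bar (handRes<d d (D q) r r) (m%n<n _ d) (handRes+hookTo-diagonal q-bar d 1≤r r≤t))
  where open DShape q-bar
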